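{- Let $G$ be a finite simple graph and $u\in V(G)$. Then $$\gamma_{gr}(G)-2\le \gamma_{gr}(G-u)\le \gamma_{gr}(G).$$ Moreover, there exist graphs $G$ such that each of the three values $\gamma_{gr}(G)-2$, $\gamma_{gr}(G)-1$, $\gamma_{gr}(G)$ is attained as $\gamma_{gr}(G-u)$ for some vertex $u\in V(G)$ (different vertices realizing different values).
   Context: For a vertex $v$ of a graph $G$, $N[v]$ denotes its closed neighborhood. A sequence $S=(v_1,\ldots,v_k)$ of distinct vertices of $G$ is a legal sequence if $N[v_i]\setminus\bigcup_{j=1}^{i-1}N[v_j]\neq\emptyset$ for every $i$. It is a dominating sequence if moreover $\{v_1,\ldots,v_k\}$ is a dominating set of $G$. The Grundy domination number $\gamma_{gr}(G)$ is the maximum length of a legal dominating sequence of $G$. $G-u$ denotes the graph obtained from $G$ by deleting the vertex $u$ and its incident edges. -}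

module Defs where

open import Data.Nat using (ℕ; suc; _≤_)
open import Data.Unit using (⊤)
open import Data.Fin using (Fin; punchIn)
open import Data.Bool using (Bool; true)
open import Data.List using (List; []; _∷_; _++_; [_]; length)
open import Data.List.Relation.Unary.All using (All)
open import Data.List.Relation.Unary.Any using (Any)
open import Data.List.Relation.Unary.Unique.Propositional using (Unique)
open import Data.Product using (Σ; _×_)
open import Data.Sum using (_⊎_)
open import Relation.Nullary using (¬_)
open import Relation.Binary.PropositionalEquality using (_≡_)

record Graph (n : ℕ) : Set where
  field
    adj    : Fin n → Fin n → Bool
    sym    : ∀ x y → adj x y ≡ adj y x
    irrefl : ∀ x → ¬ (adj x x ≡ true)
open Graph public

_∈N[_]_ : ∀ {n} → Fin n → Graph n → Fin n → Set
w ∈N[ G ] v = (w ≡ v) ⊎ (adj G v w ≡ true)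

-- LegalFrom G prev S : every vertex of S (appended after the vertices prev)
-- footprints a vertex not in the closed neighbourhood of any earlier vertex.
LegalFrom : ∀ {n} → Graph n → List (Fin n) → List (Fin n) → Set
LegalFrom G prev []      = ⊤
LegalFrom G prev (v ∷ S) =
  Σ _ (λ w → (w ∈N[ G ] v) × All (λ x → ¬ (w ∈N[ G ] x)) prev)
  × LegalFrom G (prev ++ [ v ]) S

Legal : ∀ {n} → Graph n → List (Fin n) → Set
Legal G S = Unique S × LegalFrom G [] S

Dominating : ∀ {n} → Graph n → List (Fin n) → Set
Dominating {n} G S = (w : Fin n) → Any (λ v → w ∈N[ G ] v) S

LegalDominating : ∀ {n} → Graph n → List (Fin n) → Set
LegalDominating G S = Legal G S × Dominating G S

IsGrundyDom : ∀ {n} → Graph n → ℕ → Set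
IsGrundyDom G k =
  Σ _ (λ S → LegalDominating G S × length S ≡ k)
  × (∀ S → LegalDominating G S → length S ≤ k)

delete : ∀ {n} → Graph (suc n) → Fin (suc n) → Graph n
delete G u = record
  { adj    = λ x y → adj G (punchIn u x) (punchIn u y)
  ; sym    = λ x y → sym G (punchIn u x) (punchIn u y)
  ; irrefl = λ x → irrefl G (punchIn u x)
  }

-- The key general fact is that every legal sequence extends to a legal
-- dominating one (append, one by one, the vertices not yet dominated; each
-- footprints itself).  Hence γ_gr bounds the length of every legal sequence,
-- dominating or not, and both inequalities reduce to transporting legal
-- sequences between G and G - u:
--   * a legal sequence of G - u, read in G via the embedding punchIn u, is
--     still legal (footprints stay footprints), so γ_gr(G - u) ≤ γ_gr(G);
--   * from a legal sequence of G delete u itself and the vertex (if any) whose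
--     footprint is u; both happen at most once, and every other vertex keeps a
--     footprint different from u, so the rest is legal in G - u and γ_gr(G) - 2
--     ≤ γ_gr(G - u).
-- For the example, legality, domination and "no legal sequence is longer than
-- b" are decidable; the four Grundy numbers are then established by evaluation.
module Submission where

open import Defs hiding (sym)
open import Data.Nat using (ℕ; zero; suc; _+_; _≤_; z≤n; s≤s)
open import Data.Nat.Properties using (≤-trans; ≤-reflexive; +-assoc; +-suc; m≤m+n; +-monoˡ-≤; module ≤-Reasoning)
open import Data.Fin using (Fin; punchIn; toℕ; #_)
open import Data.Fin.Properties using (punchIn-injective; punchIn-punchOut; _≟_; all?; any?)
open import Data.Bool using (Bool; true; false; _∨_)
open import Data.Bool.Properties using (∨-comm) renaming (_≟_ to _≟ᵇ_)
open import Data.List using (List; []; _∷_; _++_; [_]; length; map; allFin)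
open import Data.List.Properties using (++-assoc; ++-identityʳ; length-++; map-++; length-map)
open import Data.List.Relation.Unary.All as All using (All; []; _∷_)
open import Data.List.Relation.Unary.Any as Any using (Any; here; there)
open import Data.List.Relation.Unary.All.Properties as AllP using (¬Any⇒All¬; All¬⇒¬Any)
import Data.List.Relation.Unary.Any.Properties as AnyP
open import Data.List.Relation.Unary.Unique.Propositional using (Unique)
open import Data.List.Relation.Unary.AllPairs using ([]; _∷_)
open import Data.List.Membership.Propositional using (_∈_; _∉_)
open import Data.List.Membership.Propositional.Properties using (∈-allFin; ∈-++⁺ˡ; ∈-++⁺ʳ)
open import Data.Product using (Σ; _×_; _,_)
open import Data.Sum using (inj₁; inj₂)
open import Data.Unit using (tt)
open import Data.Empty using (⊥-elim)
open import Relation.Nullary using (¬_; Dec; yes; no; ¬?)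
open import Relation.Nullary.Decidable using (True; toWitness; _×-dec_; _⊎-dec_; _→-dec_)
open import Relation.Binary.PropositionalEquality using (_≡_; _≢_; refl; sym; cong; subst)

Dominated : ∀ {n} → Graph n → Fin n → List (Fin n) → Set
Dominated G x S = Any (λ v → x ∈N[ G ] v) S

Footprint : ∀ {n} → Graph n → List (Fin n) → Fin n → Set
Footprint G P v = Σ _ (λ w → (w ∈N[ G ] v) × All (λ x → ¬ (w ∈N[ G ] x)) P)

∈N? : ∀ {n} (G : Graph n) w v → Dec (w ∈N[ G ] v)
∈N? G w v = (w ≟ v) ⊎-dec (adj G v w ≟ᵇ true)

module LegalSequences {n} (G : Graph n) where

  legal-++ : ∀ P S T → LegalFrom G P S → LegalFrom G (P ++ S) T → LegalFrom G P (S ++ T)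
  legal-++ P []      T _ legalT = subst (λ Q → LegalFrom G Q T) (++-identityʳ P) legalT
  legal-++ P (v ∷ S) T (fp , legalS) legalT =
    fp , legal-++ (P ++ [ v ]) S T legalS (subst (λ Q → LegalFrom G Q T) (sym (++-assoc P [ v ] S)) legalT)

  -- A vertex with a footprint after P does not occur in P (it would dominate its own footprint).
  footprint⇒∉ : ∀ P {v} → Footprint G P v → v ∉ P
  footprint⇒∉ P (w , w∈Nv , fresh) v∈P = All.lookup fresh v∈P w∈Nv

  legal⇒unique : ∀ P S → LegalFrom G P S → Unique S × All (_∉ P) S
  legal⇒unique P []      _ = [] , []
  legal⇒unique P (v ∷ S) (fp , legal) with legal⇒unique (P ++ [ v ]) S legal
  ... | unique , ∉P++v =
      All.map (λ x∉ v≡x → x∉ (∈-++⁺ʳ P (here (sym v≡x)))) ∉P++v ∷ unique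
    , footprint⇒∉ P fp ∷ All.map (λ x∉ x∈P → x∉ (∈-++⁺ˡ x∈P)) ∉P++v

  legal : ∀ {S} → LegalFrom G [] S → Legal G S
  legal {S} l with legal⇒unique [] S l
  ... | unique , _ = unique , l

  -- A vertex not dominated by a legal sequence may be appended: it footprints itself.
  snoc-undominated : ∀ {S x} → LegalFrom G [] S → ¬ Dominated G x S → LegalFrom G [] (S ++ [ x ])
  snoc-undominated {S} {x} l ¬dom =
    legal-++ [] S [ x ] l ((x , inj₁ refl , ¬Any⇒All¬ S ¬dom) , tt)

  length-snoc : ∀ (S : List (Fin n)) x → length S ≤ length (S ++ [ x ])
  length-snoc S x = subst (length S ≤_) (sym (length-++ S)) (m≤m+n (length S) 1)

  dominate : ∀ xs S → LegalFrom G [] S →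
             Σ _ λ S′ → LegalFrom G [] S′ × length S ≤ length S′ × All (λ x → Dominated G x S′) xs
  dominate []       S l = S , l , ≤-reflexive refl , []
  dominate (x ∷ xs) S l with dominate xs S l
  ... | S′ , l′ , S≤S′ , dom with Any.any? (∈N? G x) S′
  ...   | yes x-dom = S′ , l′ , S≤S′ , x-dom ∷ dom
  ...   | no ¬x-dom =
          S′ ++ [ x ] , snoc-undominated l′ ¬x-dom , ≤-trans S≤S′ (length-snoc S′ x)
        , AnyP.++⁺ʳ S′ (here (inj₁ refl)) ∷ All.map AnyP.++⁺ˡ dom

  extend : ∀ {S} → LegalFrom G [] S → Σ _ λ S′ → LegalDominating G S′ × length S ≤ length S′
  extend {S} l with dominate (allFin n) S l
  ... | S′ , l′ , S≤S′ , dom = S′ , (legal l′ , λ w → All.lookup dom (∈-allFin w)) , S≤S′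

  grundy-bounds-legal : ∀ {k S} → IsGrundyDom G k → LegalFrom G [] S → length S ≤ k
  grundy-bounds-legal (_ , maximal) l with extend l
  ... | S′ , ld , S≤S′ = ≤-trans S≤S′ (maximal S′ ld)

open LegalSequences

module Deletion {n} (G : Graph (suc n)) (u : Fin (suc n)) where

  D : Graph n
  D = delete G u

  ι : Fin n → Fin (suc n)
  ι = punchIn u

  ∈N-ι⁺ : ∀ {w v} → w ∈N[ D ] v → ι w ∈N[ G ] ι v
  ∈N-ι⁺ (inj₁ w≡v) = inj₁ (cong ι w≡v)
  ∈N-ι⁺ (inj₂ wv)  = inj₂ wv

  ∈N-ι⁻ : ∀ {w v} → ι w ∈N[ G ] ι v → w ∈N[ D ] v
  ∈N-ι⁻ (inj₁ ιw≡ιv) = inj₁ (punchIn-injective u _ _ ιw≡ιv)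
  ∈N-ι⁻ (inj₂ wv)    = inj₂ wv

  preimage : ∀ {v} → v ≢ u → Σ _ λ v′ → ι v′ ≡ v
  preimage v≢u = _ , punchIn-punchOut (λ u≡v → v≢u (sym u≡v))

  lift : ∀ P S → LegalFrom D P S → LegalFrom G (map ι P) (map ι S)
  lift P []      _ = tt
  lift P (v ∷ S) ((w , w∈Nv , fresh) , l) =
      (ι w , ∈N-ι⁺ w∈Nv , AllP.map⁺ (All.map (λ ¬w∈Nx w∈Nx → ¬w∈Nx (∈N-ι⁻ w∈Nx)) fresh))
    , subst (λ Q → LegalFrom G Q (map ι S)) (map-++ ι P [ v ]) (lift (P ++ [ v ]) S l)

  budget-u : ∀ s t a b → s ≤ t + a + b → suc s ≤ t + suc a + b
  budget-u s t a b s≤ rewrite +-suc t a = s≤s s≤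

  budget-footprint : ∀ s t a b → s ≤ t + a + b → suc s ≤ t + a + suc b
  budget-footprint s t a b s≤ rewrite +-suc (t + a) b = s≤s s≤

  -- The kept
  -- vertices Q lie in P; the budget a pays for meeting u itself (a = 0 only
  -- once u ∈ P) and b for meeting a vertex whose footprint is u (b = 0 only
  -- once u is dominated by P).
  restrict : ∀ P Q S a b → All (λ q → ι q ∈ P) Q → (a ≡ 0 → u ∈ P) → (b ≡ 0 → Dominated G u P) →
             LegalFrom G P S → Σ _ λ T → LegalFrom D Q T × length S ≤ length T + a + b
  restrict P Q [] a b _ _ _ _ = [] , tt , z≤n
  restrict P Q (v ∷ S) a b Q⊆P u∈P u-dom ((w , w∈Nv , fresh) , l) with v ≟ u | w ≟ u
  restrict P Q (v ∷ S) zero b Q⊆P u∈P u-dom ((w , w∈Nv , fresh) , l) | yes refl | _ =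
    ⊥-elim (footprint⇒∉ G P (w , w∈Nv , fresh) (u∈P refl))
  restrict P Q (v ∷ S) (suc a) b Q⊆P u∈P u-dom ((w , w∈Nv , fresh) , l) | yes refl | _
    with restrict (P ++ [ v ]) Q S a b (All.map ∈-++⁺ˡ Q⊆P) (λ _ → ∈-++⁺ʳ P (here refl))
                  (λ b≡0 → AnyP.++⁺ˡ (u-dom b≡0)) l
  ... | T , lT , len = T , lT , budget-u _ _ a b len
  restrict P Q (v ∷ S) a zero Q⊆P u∈P u-dom ((w , w∈Nv , fresh) , l) | no _ | yes refl =
    ⊥-elim (All¬⇒¬Any fresh (u-dom refl))
  restrict P Q (v ∷ S) a (suc b) Q⊆P u∈P u-dom ((w , w∈Nv , fresh) , l) | no _ | yes refl
    with restrict (P ++ [ v ]) Q S a b (All.map ∈-++⁺ˡ Q⊆P) (λ a≡0 → ∈-++⁺ˡ (u∈P a≡0))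
                  (λ _ → AnyP.++⁺ʳ P (here w∈Nv)) l
  ... | T , lT , len = T , lT , budget-footprint _ _ a b len
  restrict P Q (v ∷ S) a b Q⊆P u∈P u-dom ((w , w∈Nv , fresh) , l) | no v≢u | no w≢u
    with preimage v≢u | preimage w≢u
  ... | v′ , refl | w′ , refl
    with restrict (P ++ [ ι v′ ]) (Q ++ [ v′ ]) S a b
                  (AllP.++⁺ (All.map ∈-++⁺ˡ Q⊆P) (∈-++⁺ʳ P (here refl) ∷ []))
                  (λ a≡0 → ∈-++⁺ˡ (u∈P a≡0)) (λ b≡0 → AnyP.++⁺ˡ (u-dom b≡0)) l
  ... | T , lT , len = v′ ∷ T , ((w′ , ∈N-ι⁻ w∈Nv , fresh′) , lT) , s≤s len
    where
    fresh′ : All (λ q → ¬ (w′ ∈N[ D ] q)) Q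
    fresh′ = All.map (λ ιq∈P w′∈Nq → All.lookup fresh ιq∈P (∈N-ι⁺ w′∈Nq)) Q⊆P

  deletion-upper : ∀ {k k′} → IsGrundyDom G k → IsGrundyDom D k′ → k′ ≤ k
  deletion-upper gG ((S , ((_ , l) , _) , refl) , _) =
    ≤-trans (≤-reflexive (sym (length-map ι S))) (grundy-bounds-legal G gG (lift [] S l))

  deletion-lower : ∀ {k k′} → IsGrundyDom G k → IsGrundyDom D k′ → k ≤ k′ + 2
  deletion-lower {k′ = k′} ((S , ((_ , l) , _) , refl) , _) gD
    with restrict [] [] S 1 1 [] (λ ()) (λ ()) l
  ... | T , lT , len = begin
      length S           ≤⟨ len ⟩
      length T + 1 + 1   ≤⟨ +-monoˡ-≤ 1 (+-monoˡ-≤ 1 (grundy-bounds-legal D gD lT)) ⟩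
      k′ + 1 + 1         ≡⟨ +-assoc k′ 1 1 ⟩
      k′ + 2             ∎
    where open ≤-Reasoning

module Decision {m} (H : Graph m) where

  footprint? : ∀ P v → Dec (Footprint H P v)
  footprint? P v = any? (λ w → ∈N? H w v ×-dec All.all? (λ x → ¬? (∈N? H w x)) P)

  legalFrom? : ∀ P S → Dec (LegalFrom H P S)
  legalFrom? P []      = yes tt
  legalFrom? P (v ∷ S) = footprint? P v ×-dec legalFrom? (P ++ [ v ]) S

  dominating? : ∀ S → Dec (Dominating H S)
  dominating? S = all? (λ w → Any.any? (∈N? H w) S)

  -- LengthBound b P: every legal continuation of P has at most b vertices,
  -- unfolded one vertex at a time so that it becomes decidable.
  LengthBound : ℕ → List (Fin m) → Set
  LengthBound zero    P = ∀ v → ¬ Footprint H P v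
  LengthBound (suc b) P = ∀ v → Footprint H P v → LengthBound b (P ++ [ v ])

  lengthBound? : ∀ b P → Dec (LengthBound b P)
  lengthBound? zero    P = all? (λ v → ¬? (footprint? P v))
  lengthBound? (suc b) P = all? (λ v → footprint? P v →-dec lengthBound? b (P ++ [ v ]))

  lengthBound-sound : ∀ b P S → LengthBound b P → LegalFrom H P S → length S ≤ b
  lengthBound-sound b       P []      _     _        = z≤n
  lengthBound-sound zero    P (v ∷ S) bound (fp , _) = ⊥-elim (bound v fp)
  lengthBound-sound (suc b) P (v ∷ S) bound (fp , l) = s≤s (lengthBound-sound b (P ++ [ v ]) S (bound v fp) l)

  grundy-by-decision : ∀ S k → True (legalFrom? [] S) → True (dominating? S) → length S ≡ k →
                       True (lengthBound? k []) → IsGrundyDom H k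
  grundy-by-decision S k l dom len bound =
      (S , (legal H (toWitness l) , toWitness dom) , len)
    , λ S′ ((_ , l′) , _) → lengthBound-sound k [] S′ (toWitness bound) l′

symmetricClosure : ∀ {n} (e : Fin n → Fin n → Bool) → (∀ x → e x x ≡ false) → Graph n
symmetricClosure e loopless = record
  { adj    = λ x y → e x y ∨ e y x
  ; sym    = λ x y → ∨-comm (e x y) (e y x)
  ; irrefl = λ x → subst (λ b → ¬ (b ∨ b ≡ true)) (sym (loopless x)) (λ ())
  }

-- The example: the triangle 1 2 3 with the path 1 - 4 - 0 - 5 attached at 1.
exampleEdge : ℕ → ℕ → Bool
exampleEdge 0 4 = true
exampleEdge 0 5 = true
exampleEdge 1 2 = true
exampleEdge 1 3 = true
exampleEdge 1 4 = true
exampleEdge 2 3 = true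
exampleEdge _ _ = false

exampleEdge-loopless : ∀ i → exampleEdge i i ≡ false
exampleEdge-loopless 0 = refl
exampleEdge-loopless 1 = refl
exampleEdge-loopless 2 = refl
exampleEdge-loopless 3 = refl
exampleEdge-loopless (suc (suc (suc (suc _)))) = refl

example : Graph 6
example = symmetricClosure (λ x y → exampleEdge (toℕ x) (toℕ y)) (λ x → exampleEdge-loopless (toℕ x))

example-grundy : IsGrundyDom example 4
example-grundy = Decision.grundy-by-decision example (# 2 ∷ # 1 ∷ # 4 ∷ # 0 ∷ []) 4 tt tt refl tt

-- Deleting 4 leaves K₃ plus K₂: γ_gr = 2.
example-minus-4 : IsGrundyDom (delete example (# 4)) 2
example-minus-4 = Decision.grundy-by-decision _ (# 0 ∷ # 1 ∷ []) 2 tt tt refl tt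

-- Deleting 0 leaves K₃ with a pendant vertex, plus an isolated vertex: γ_gr = 3.
example-minus-0 : IsGrundyDom (delete example (# 0)) 3
example-minus-0 = Decision.grundy-by-decision _ (# 1 ∷ # 0 ∷ # 4 ∷ []) 3 tt tt refl tt

-- Deleting 2 leaves the path 3 - 1 - 4 - 0 - 5: γ_gr = 4.
example-minus-2 : IsGrundyDom (delete example (# 2)) 4
example-minus-2 = Decision.grundy-by-decision _ (# 2 ∷ # 1 ∷ # 3 ∷ # 0 ∷ []) 4 tt tt refl tt

theorem2p3 :
    ((n : ℕ) (G : Graph (suc n)) (u : Fin (suc n)) (k k′ : ℕ) →
      IsGrundyDom G k → IsGrundyDom (delete G u) k′ →
      (k ≤ k′ + 2) × (k′ ≤ k))
    × Σ ℕ (λ n → Σ (Graph (suc n)) (λ G → Σ ℕ (λ k →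
        Σ (Fin (suc n)) (λ u₀ → Σ (Fin (suc n)) (λ u₁ → Σ (Fin (suc n)) (λ u₂ →
          IsGrundyDom G (k + 2)
          × IsGrundyDom (delete G u₀) k
          × IsGrundyDom (delete G u₁) (k + 1)
          × IsGrundyDom (delete G u₂) (k + 2)
          × ¬ (u₀ ≡ u₁) × ¬ (u₀ ≡ u₂) × ¬ (u₁ ≡ u₂)))))))
theorem2p3 =
    (λ n G u k k′ gG gD → Deletion.deletion-lower G u gG gD , Deletion.deletion-upper G u gG gD)
  , ( 5 , example , 2 , # 4 , # 0 , # 2
    , example-grundy , example-minus-4 , example-minus-0 , example-minus-2
    , (λ ()) , (λ ()) , (λ ()) )
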